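{- If a permutation $w\in S_n$ contains one of the patterns $3421$, $4312$, $4321$, $456123$, then there exists a reduced expression $w=s_{i_1}\cdots s_{i_\ell}$ in which some simple transposition $s_k=(k\ k+1)$ appears at least $3$ times.
   Context: Reduced expressions are words of minimal length in the simple transpositions $s_i=(i\ i+1)$. Pattern containment is classical permutation pattern containment (a subsequence of the one-line notation in the same relative order as the pattern). -}

module Defs where

open import Data.Nat using (ℕ; zero; suc; _<_; _≤_; _≥_)
open import Data.Nat.Properties using (_≟_)
open import Data.Fin using (Fin; zero; suc; toℕ)
open import Data.Fin.Permutation using (Permutation′; _⟨$⟩ʳ_)
open import Data.List using (List; []; _∷_; length; filter)
open import Data.List.Relation.Unary.All using (All)
open import Data.Product using (Σ; ∃; _×_; _,_)
open import Data.Sum using (_⊎_)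
open import Data.Vec using (Vec; []; _∷_; lookup)
open import Function using (id; _∘_; _⇔_)
open import Relation.Binary.PropositionalEquality using (_≡_)

-- Simple transposition s_k = (k k+1) acting on Fin n, with 0-based positions:
-- swaps positions k and k+1 (0-based).  (If k+1 ≥ n it is the identity, but
-- words below are required to use only valid letters k with k+1 < n.)
swapAt : ∀ {n} → ℕ → Fin n → Fin n
swapAt {suc (suc n)} zero zero = suc zero
swapAt {suc (suc n)} zero (suc zero) = zero
swapAt zero j = j
swapAt (suc k) zero = zero
swapAt (suc k) (suc j) = suc (swapAt k j)

ValidWord : ℕ → List ℕ → Set
ValidWord n u = All (λ k → suc k < n) u

evalWord : ∀ {n} → List ℕ → Fin n → Fin n
evalWord [] = id
evalWord (k ∷ u) = swapAt k ∘ evalWord u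

IsExpression : ∀ {n} → Permutation′ n → List ℕ → Set
IsExpression {n} w u = ValidWord n u × (∀ j → evalWord u j ≡ w ⟨$⟩ʳ j)

IsReduced : ∀ {n} → Permutation′ n → List ℕ → Set
IsReduced {n} w u =
  IsExpression w u × (∀ v → IsExpression w v → length u ≤ length v)

count : ℕ → List ℕ → ℕ
count k u = length (filter (k ≟_) u)

-- Classical pattern containment: a pattern of length m in one-line notation
-- (values given as a Vec ℕ m; only relative order matters) occurs in w if there
-- are positions f 0 < f 1 < ... < f (m-1) whose values are in the same relative order.
Contains : ∀ {n m} → Permutation′ n → Vec ℕ m → Set
Contains {n} {m} w p =
  Σ (Fin m → Fin n) λ f →
    (∀ a b → toℕ a < toℕ b → toℕ (f a) < toℕ (f b)) ×
    (∀ a b → (toℕ (w ⟨$⟩ʳ f a) < toℕ (w ⟨$⟩ʳ f b)) ⇔ (lookup p a < lookup p b))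

p3421 : Vec ℕ 4
p3421 = 3 ∷ 4 ∷ 2 ∷ 1 ∷ []

p4312 : Vec ℕ 4
p4312 = 4 ∷ 3 ∷ 1 ∷ 2 ∷ []

p4321 : Vec ℕ 4
p4321 = 4 ∷ 3 ∷ 2 ∷ 1 ∷ []

p456123 : Vec ℕ 6
p456123 = 4 ∷ 5 ∷ 6 ∷ 1 ∷ 2 ∷ 3 ∷ []

module Submission where

-- Left multiplication by s_k swaps the values k and k+1 of w.  It changes the number of inversions
-- by at most one, and lowers it exactly when k+1 stands to the left of k (a left descent at k);
-- so peeling off left descents one at a time yields an expression of length inv(w), which is
-- therefore reduced.  Fix an occurrence of the pattern and first peel off every left descent that
-- does not swap two of its values: the occurrence survives.  Once no such descent is left the
-- occurrence is rigid: two values of it that are adjacent among its values and inverted in position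
-- differ by one, and between two such values in increasing position w has no left descent at all,
-- so the intermediate values stand in increasing order between them.  For each of the four
-- patterns this gives an occurrence on consecutive values m, …, m + r - 1, and peeling along a
-- reduced word of the pattern shifted by m (010210 for 4321, 10121 for 3421, 12101 for 4312,
-- 210321432 for 456123, read as successive left descents) uses one letter three times.

open import Defs
open import Data.Empty using (⊥-elim)
open import Data.Fin using (Fin; zero; suc; toℕ; fromℕ<; inject₁)
open import Data.Fin.Patterns using (0F; 1F; 2F; 3F; 4F; 5F)
open import Data.Fin.Permutation
  using (Permutation′; permutation; _⟨$⟩ʳ_; _⟨$⟩ˡ_; _∘ₚ_; inverseˡ; inverseʳ; _≈_)
  renaming (id to idₚ)
open import Data.Fin.Properties
  using (toℕ<n; toℕ-injective; toℕ-fromℕ<; fromℕ<-toℕ; any?; all?)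
  renaming (_≟_ to _≟ᶠ_; suc-injective to sucᶠ-injective)
open import Data.List using (List; []; _∷_; length)
open import Data.List.Properties using (filter-accept; filter-reject)
open import Data.List.Relation.Unary.All using ([]; _∷_)
open import Data.Nat
open import Data.Nat.Induction using (<-wellFounded)
open import Data.Nat.Properties
open import Algebra.Properties.CommutativeMonoid.Sum +-0-commutativeMonoid
  using (sum; sum-cong-≗; ∑-distrib-+; sum-replicate-zero)
open import Data.Product using (Σ; ∃; ∃₂; _×_; _,_)
open import Data.Sum using (_⊎_; inj₁; inj₂)
open import Data.Unit using (⊤; tt)
open import Data.Vec using (Vec; []; _∷_; lookup)
open import Function using (_∘_; _⇔_; mk⇔; Equivalence)
open import Induction.WellFounded using (Acc; acc)
open import Relation.Binary using (tri<; tri≈; tri>)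
open import Relation.Binary.PropositionalEquality
open import Relation.Nullary using (¬_; Dec; yes; no; ¬?)
open import Relation.Nullary.Decidable using (True; toWitness; _×-dec_)

private variable A B C : Set

swapℕ : ℕ → ℕ → ℕ
swapℕ zero    zero          = 1
swapℕ zero    (suc zero)    = 0
swapℕ zero    (suc (suc x)) = suc (suc x)
swapℕ (suc k) zero          = zero
swapℕ (suc k) (suc x)       = suc (swapℕ k x)

swapℕ-involutive : ∀ k x → swapℕ k (swapℕ k x) ≡ x
swapℕ-involutive zero    zero          = refl
swapℕ-involutive zero    (suc zero)    = refl
swapℕ-involutive zero    (suc (suc x)) = refl
swapℕ-involutive (suc k) zero          = refl
swapℕ-involutive (suc k) (suc x)       = cong suc (swapℕ-involutive k x)

swapℕ-self : ∀ k → swapℕ k k ≡ suc k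
swapℕ-self zero    = refl
swapℕ-self (suc k) = cong suc (swapℕ-self k)

swapℕ-suc : ∀ k → swapℕ k (suc k) ≡ k
swapℕ-suc zero    = refl
swapℕ-suc (suc k) = cong suc (swapℕ-suc k)

swapℕ-+ : ∀ m k x → swapℕ (m + k) (m + x) ≡ m + swapℕ k x
swapℕ-+ zero    k x = refl
swapℕ-+ (suc m) k x = cong suc (swapℕ-+ m k x)

swapℕ-+ʳ : ∀ k x m → swapℕ (k + m) (x + m) ≡ swapℕ k x + m
swapℕ-+ʳ k x m = begin
  swapℕ (k + m) (x + m) ≡⟨ cong₂ swapℕ (+-comm k m) (+-comm x m) ⟩
  swapℕ (m + k) (m + x) ≡⟨ swapℕ-+ m k x ⟩
  m + swapℕ k x         ≡⟨ +-comm m (swapℕ k x) ⟩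
  swapℕ k x + m         ∎
  where open ≡-Reasoning

swapℕ-reflects-< : ∀ k {a b} → swapℕ k a < swapℕ k b → a < b ⊎ (a ≡ suc k × b ≡ k)
swapℕ-reflects-< zero    {zero}        {suc (suc b)} _       = inj₁ z<s
swapℕ-reflects-< zero    {suc zero}    {zero}        _       = inj₂ (refl , refl)
swapℕ-reflects-< zero    {suc zero}    {suc (suc b)} _       = inj₁ (s<s z<s)
swapℕ-reflects-< zero    {suc (suc a)} {suc (suc b)} a<b     = inj₁ a<b
swapℕ-reflects-< zero    {zero}        {zero}        (s<s ())
swapℕ-reflects-< zero    {suc zero}    {suc zero}    ()
swapℕ-reflects-< zero    {suc (suc a)} {zero}        (s<s ())
swapℕ-reflects-< zero    {suc (suc a)} {suc zero}    ()
swapℕ-reflects-< (suc k) {zero}        {suc b}       _       = inj₁ z<s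
swapℕ-reflects-< (suc k) {suc a}       {suc b}       (s<s lt) with swapℕ-reflects-< k lt
... | inj₁ a<b           = inj₁ (s<s a<b)
... | inj₂ (refl , refl) = inj₂ (refl , refl)

swapℕ-mono-< : ∀ k {a b} → a < b → ¬ (a ≡ k × b ≡ suc k) → swapℕ k a < swapℕ k b
swapℕ-mono-< k {a} {b} a<b not-swapped with swapℕ-reflects-< k {swapℕ k a} {swapℕ k b}
  (subst₂ _<_ (sym (swapℕ-involutive k a)) (sym (swapℕ-involutive k b)) a<b)
... | inj₁ lt          = lt
... | inj₂ (ea , eb) = ⊥-elim (not-swapped
  ( trans (sym (swapℕ-involutive k a)) (trans (cong (swapℕ k) ea) (swapℕ-suc k))
  , trans (sym (swapℕ-involutive k b)) (trans (cong (swapℕ k) eb) (swapℕ-self k))))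

swapAt-involutive : ∀ {n} k (x : Fin n) → swapAt k (swapAt k x) ≡ x
swapAt-involutive {suc zero}    zero    zero          = refl
swapAt-involutive {suc (suc n)} zero    zero          = refl
swapAt-involutive {suc (suc n)} zero    (suc zero)    = refl
swapAt-involutive {suc (suc n)} zero    (suc (suc x)) = refl
swapAt-involutive {suc zero}    (suc k) zero          = refl
swapAt-involutive {suc (suc n)} (suc k) zero          = refl
swapAt-involutive {suc (suc n)} (suc k) (suc x)       = cong suc (swapAt-involutive k x)

toℕ-swapAt : ∀ {n} k (x : Fin n) → suc k < n → toℕ (swapAt k x) ≡ swapℕ k (toℕ x)
toℕ-swapAt {suc zero}    zero    zero          (s<s ())
toℕ-swapAt {suc (suc n)} zero    zero          _         = refl
toℕ-swapAt {suc (suc n)} zero    (suc zero)    _         = refl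
toℕ-swapAt {suc (suc n)} zero    (suc (suc x)) _         = refl
toℕ-swapAt {suc zero}    (suc k) zero          _         = refl
toℕ-swapAt {suc (suc n)} (suc k) zero          _         = refl
toℕ-swapAt {suc (suc n)} (suc k) (suc x)       (s<s k<n) = cong suc (toℕ-swapAt k x k<n)

indicator : Dec A → ℕ
indicator (yes _) = 1
indicator (no _)  = 0

indicator-yes : (a? : Dec A) → A → indicator a? ≡ 1
indicator-yes (yes _) _ = refl
indicator-yes (no ¬a) a = ⊥-elim (¬a a)

indicator-no : (a? : Dec A) → ¬ A → indicator a? ≡ 0
indicator-no (yes a) ¬a = ⊥-elim (¬a a)
indicator-no (no _)  _  = refl

indicator-cong : (a? : Dec A) (b? : Dec B) → A ⇔ B → indicator a? ≡ indicator b?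
indicator-cong (yes a) b? A⇔B = sym (indicator-yes b? (Equivalence.to A⇔B a))
indicator-cong (no ¬a) b? A⇔B = sym (indicator-no b? (¬a ∘ Equivalence.from A⇔B))

indicator-≤-+ : (a? : Dec A) (b? : Dec B) (c? : Dec C) →
                (A → B ⊎ C) → indicator a? ≤ indicator b? + indicator c?
indicator-≤-+ (no _)  _       _       _ = z≤n
indicator-≤-+ (yes _) (yes _) _       _ = s≤s z≤n
indicator-≤-+ (yes _) (no _)  (yes _) _ = s≤s z≤n
indicator-≤-+ (yes a) (no ¬b) (no ¬c) A⇒B⊎C with A⇒B⊎C a
... | inj₁ b = ⊥-elim (¬b b)
... | inj₂ c = ⊥-elim (¬c c)

indicator-+-≤ : (a? : Dec A) (c? : Dec C) (b? : Dec B) →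
                (A → B) → (C → B) → (C → ¬ A) → indicator a? + indicator c? ≤ indicator b?
indicator-+-≤ (no _)  (no _)  _       _   _   _    = z≤n
indicator-+-≤ (yes _) (no _)  (yes _) _   _   _    = s≤s z≤n
indicator-+-≤ (no _)  (yes _) (yes _) _   _   _    = s≤s z≤n
indicator-+-≤ (yes a) (yes c) _       _   _   C⇒¬A = ⊥-elim (C⇒¬A c a)
indicator-+-≤ (yes a) (no _)  (no ¬b) A⇒B _   _    = ⊥-elim (¬b (A⇒B a))
indicator-+-≤ (no _)  (yes c) (no ¬b) _   C⇒B _    = ⊥-elim (¬b (C⇒B c))

sum-mono-≤ : ∀ {n} {f g : Fin n → ℕ} → (∀ i → f i ≤ g i) → sum f ≤ sum g
sum-mono-≤ {zero}  _   = z≤n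
sum-mono-≤ {suc n} f≤g = +-mono-≤ (f≤g zero) (sum-mono-≤ (f≤g ∘ suc))

sum-zero : ∀ {n} {f : Fin n → ℕ} → (∀ i → f i ≡ 0) → sum f ≡ 0
sum-zero {n} f≡0 = trans (sum-cong-≗ f≡0) (sum-replicate-zero n)

sum-indicator-≟ : ∀ {n} (q : Fin n) → sum (λ j → indicator (q ≟ᶠ j)) ≡ 1
sum-indicator-≟ {suc n} zero = cong₂ _+_
  (indicator-yes (zero {n} ≟ᶠ zero) refl)
  (sum-zero {n} λ j → indicator-no (zero ≟ᶠ suc j) λ ())
sum-indicator-≟ {suc n} (suc q) = cong₂ _+_
  (indicator-no (suc q ≟ᶠ zero) λ ())
  (trans (sum-cong-≗ {n} λ j →
            indicator-cong (suc q ≟ᶠ suc j) (q ≟ᶠ j) (mk⇔ sucᶠ-injective (cong suc)))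
         (sum-indicator-≟ q))

∑∑ : ∀ {n} → (Fin n → Fin n → ℕ) → ℕ
∑∑ f = sum λ i → sum (f i)

∑∑-distrib-+ : ∀ {n} (f g : Fin n → Fin n → ℕ) → ∑∑ (λ i j → f i j + g i j) ≡ ∑∑ f + ∑∑ g
∑∑-distrib-+ {n} f g =
  trans (sum-cong-≗ λ i → ∑-distrib-+ {n} (f i) (g i)) (∑-distrib-+ {n} (sum ∘ f) (sum ∘ g))

pointIndicator : ∀ {n} → Fin n → Fin n → Fin n → Fin n → ℕ
pointIndicator p q i j = indicator ((p ≟ᶠ i) ×-dec (q ≟ᶠ j))

∑∑-pointIndicator : ∀ {n} (p q : Fin n) → ∑∑ (pointIndicator p q) ≡ 1
∑∑-pointIndicator {n} p q = trans (sum-cong-≗ row) (sum-indicator-≟ p)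
  where
  row : ∀ i → sum (pointIndicator p q i) ≡ indicator (p ≟ᶠ i)
  row i with p ≟ᶠ i
  ... | yes refl = trans
    (sum-cong-≗ {n} λ j → indicator-cong _ (q ≟ᶠ j) (mk⇔ (λ (_ , e) → e) (refl ,_)))
    (sum-indicator-≟ q)
  ... | no p≢i   = sum-zero {n} λ j → indicator-no (no p≢i ×-dec (q ≟ᶠ j)) (λ (e , _) → p≢i e)

∑∑-≤-suc : ∀ {n} {f g : Fin n → Fin n → ℕ} (p q : Fin n) →
           (∀ i j → f i j ≤ g i j + pointIndicator p q i j) → ∑∑ f ≤ suc (∑∑ g)
∑∑-≤-suc {f = f} {g} p q pointwise = begin
  ∑∑ f                                        ≤⟨ sum-mono-≤ (λ i → sum-mono-≤ (pointwise i)) ⟩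
  ∑∑ (λ i j → g i j + pointIndicator p q i j) ≡⟨ ∑∑-distrib-+ g (pointIndicator p q) ⟩
  ∑∑ g + ∑∑ (pointIndicator p q)              ≡⟨ cong (∑∑ g +_) (∑∑-pointIndicator p q) ⟩
  ∑∑ g + 1                                    ≡⟨ +-comm (∑∑ g) 1 ⟩
  suc (∑∑ g)                                  ∎
  where open ≤-Reasoning

∑∑-suc-≤ : ∀ {n} {f g : Fin n → Fin n → ℕ} (p q : Fin n) →
           (∀ i j → f i j + pointIndicator p q i j ≤ g i j) → suc (∑∑ f) ≤ ∑∑ g
∑∑-suc-≤ {f = f} {g} p q pointwise = begin
  suc (∑∑ f)                                  ≡⟨ +-comm 1 (∑∑ f) ⟩
  ∑∑ f + 1                                    ≡⟨ cong (∑∑ f +_) (∑∑-pointIndicator p q) ⟨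
  ∑∑ f + ∑∑ (pointIndicator p q)              ≡⟨ ∑∑-distrib-+ f (pointIndicator p q) ⟨
  ∑∑ (λ i j → f i j + pointIndicator p q i j) ≤⟨ sum-mono-≤ (λ i → sum-mono-≤ (pointwise i)) ⟩
  ∑∑ g                                        ∎
  where open ≤-Reasoning

value : ∀ {n} → Permutation′ n → Fin n → ℕ
value w i = toℕ (w ⟨$⟩ʳ i)

value-injective : ∀ {n} (w : Permutation′ n) {i j} → value w i ≡ value w j → i ≡ j
value-injective w {i} {j} eq = begin
  i                 ≡⟨ inverseˡ w ⟨
  w ⟨$⟩ˡ (w ⟨$⟩ʳ i) ≡⟨ cong (w ⟨$⟩ˡ_) (toℕ-injective eq) ⟩
  w ⟨$⟩ˡ (w ⟨$⟩ʳ j) ≡⟨ inverseˡ w ⟩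
  j                 ∎
  where open ≡-Reasoning

positionOf : ∀ {n} → Permutation′ n → (x : ℕ) → x < n → Fin n
positionOf w x x<n = w ⟨$⟩ˡ fromℕ< x<n

value-positionOf : ∀ {n} (w : Permutation′ n) x (x<n : x < n) → value w (positionOf w x x<n) ≡ x
value-positionOf w x x<n = trans (cong toℕ (inverseʳ w)) (toℕ-fromℕ< x<n)

positionOf-unique : ∀ {n} (w : Permutation′ n) x (x<n : x < n) {i} →
                    value w i ≡ x → positionOf w x x<n ≡ i
positionOf-unique w x x<n vi≡x = value-injective w (trans (value-positionOf w x x<n) (sym vi≡x))

swapₚ : ∀ {n} → ℕ → Permutation′ n
swapₚ k = permutation (swapAt k) (swapAt k) (swapAt-involutive k) (swapAt-involutive k)

-- s_k w: _∘ₚ_ composes in diagrammatic order, so w is applied first.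
swapValues : ∀ {n} → ℕ → Permutation′ n → Permutation′ n
swapValues k w = w ∘ₚ swapₚ k

value-swapValues : ∀ {n} k (w : Permutation′ n) → suc k < n →
                   ∀ i → value (swapValues k w) i ≡ swapℕ k (value w i)
value-swapValues k w k+1<n i = toℕ-swapAt k (w ⟨$⟩ʳ i) k+1<n

wordₚ : ∀ {n} → List ℕ → Permutation′ n
wordₚ []      = idₚ
wordₚ (k ∷ u) = swapValues k (wordₚ u)

wordₚ-evalWord : ∀ {n} u (x : Fin n) → wordₚ u ⟨$⟩ʳ x ≡ evalWord u x
wordₚ-evalWord []      x = refl
wordₚ-evalWord (k ∷ u) x = cong (swapAt k) (wordₚ-evalWord u x)

HasDescentAt : ∀ {r} → (Fin r → ℕ) → ℕ → Set
HasDescentAt v k = ∃₂ λ i j → toℕ i < toℕ j × v i ≡ suc k × v j ≡ k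

hasDescentAt? : ∀ {r} (v : Fin r → ℕ) k → Dec (HasDescentAt v k)
hasDescentAt? v k = any? λ i → any? λ j → (toℕ i <? toℕ j) ×-dec (v i ≟ suc k) ×-dec (v j ≟ k)

descent⇒suc<n : ∀ {n} (w : Permutation′ n) {k} → HasDescentAt (value w) k → suc k < n
descent⇒suc<n w (i , _ , _ , vi≡k+1 , _) = subst (_< _) vi≡k+1 (toℕ<n (w ⟨$⟩ʳ i))

IsInversion : ∀ {n} → Permutation′ n → Fin n → Fin n → Set
IsInversion w i j = toℕ i < toℕ j × value w j < value w i

isInversion? : ∀ {n} (w : Permutation′ n) i j → Dec (IsInversion w i j)
isInversion? w i j = (toℕ i <? toℕ j) ×-dec (value w j <? value w i)

isInversion-cong : ∀ {n} (w w′ : Permutation′ n) → w ≈ w′ →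
                   ∀ {i j} → IsInversion w i j → IsInversion w′ i j
isInversion-cong w w′ w≈w′ {i} {j} (i<j , vj<vi) =
  i<j , subst₂ _<_ (cong toℕ (w≈w′ j)) (cong toℕ (w≈w′ i)) vj<vi

inversions : ∀ {n} → Permutation′ n → ℕ
inversions w = ∑∑ λ i j → indicator (isInversion? w i j)

inversions-cong : ∀ {n} (w w′ : Permutation′ n) → w ≈ w′ → inversions w ≡ inversions w′
inversions-cong {n} w w′ w≈w′ = sum-cong-≗ {n} λ i → sum-cong-≗ {n} λ j →
  indicator-cong (isInversion? w i j) (isInversion? w′ i j)
    (mk⇔ (isInversion-cong w w′ w≈w′) (isInversion-cong w′ w (sym ∘ w≈w′)))

inversions-id : ∀ {n} → inversions (idₚ {n}) ≡ 0
inversions-id {n} = sum-zero {n} λ i → sum-zero {n} λ j →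
  indicator-no (isInversion? idₚ i j) λ (i<j , j<i) → <-asym i<j j<i

inversions-swapValues-≤ : ∀ {n} k (w : Permutation′ n) → suc k < n →
                          inversions (swapValues k w) ≤ suc (inversions w)
inversions-swapValues-≤ k w k+1<n = ∑∑-≤-suc p q λ i j →
  indicator-≤-+ (isInversion? (swapValues k w) i j) (isInversion? w i j) _ (new-inversion i j)
  where
  k<n = <-trans (n<1+n k) k+1<n
  p = positionOf w k k<n
  q = positionOf w (suc k) k+1<n
  new-inversion : ∀ i j → IsInversion (swapValues k w) i j → IsInversion w i j ⊎ (p ≡ i × q ≡ j)
  new-inversion i j (i<j , lt)
    with swapℕ-reflects-< k (subst₂ _<_ (value-swapValues k w k+1<n j) (value-swapValues k w k+1<n i) lt)
  ... | inj₁ vj<vi           = inj₁ (i<j , vj<vi)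
  ... | inj₂ (vj≡k+1 , vi≡k) =
    inj₂ (positionOf-unique w k k<n vi≡k , positionOf-unique w (suc k) k+1<n vj≡k+1)

inversions-swapValues-descent : ∀ {n} k (w : Permutation′ n) → HasDescentAt (value w) k →
                                suc (inversions (swapValues k w)) ≤ inversions w
inversions-swapValues-descent k w descent@(i₀ , j₀ , i₀<j₀ , vi₀≡k+1 , vj₀≡k) =
  ∑∑-suc-≤ i₀ j₀ λ i j →
  indicator-+-≤ (isInversion? (swapValues k w) i j) _ (isInversion? w i j)
    (old-inversion i j) removed-was-inversion removed-is-not-inversion
  where
  swapped : ∀ i → value (swapValues k w) i ≡ swapℕ k (value w i)
  swapped = value-swapValues k w (descent⇒suc<n w descent)
  old-inversion : ∀ i j → IsInversion (swapValues k w) i j → IsInversion w i j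
  old-inversion i j (i<j , lt) with swapℕ-reflects-< k (subst₂ _<_ (swapped j) (swapped i) lt)
  ... | inj₁ vj<vi = i<j , vj<vi
  ... | inj₂ (vj≡k+1 , vi≡k)
    with value-injective w (trans vj≡k+1 (sym vi₀≡k+1)) | value-injective w (trans vi≡k (sym vj₀≡k))
  ... | refl | refl = ⊥-elim (<-asym i<j i₀<j₀)
  removed-was-inversion : ∀ {i j} → i₀ ≡ i × j₀ ≡ j → IsInversion w i j
  removed-was-inversion (refl , refl) = i₀<j₀ , subst₂ _<_ (sym vj₀≡k) (sym vi₀≡k+1) (n<1+n k)
  removed-is-not-inversion : ∀ {i j} → i₀ ≡ i × j₀ ≡ j → ¬ IsInversion (swapValues k w) i j
  removed-is-not-inversion (refl , refl) (_ , lt) = <-asym (n<1+n k) (subst₂ _<_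
    (trans (swapped j₀) (trans (cong (swapℕ k) vj₀≡k) (swapℕ-self k)))
    (trans (swapped i₀) (trans (cong (swapℕ k) vi₀≡k+1) (swapℕ-suc k))) lt)

inversions-wordₚ-≤ : ∀ {n} u → ValidWord n u → inversions (wordₚ {n} u) ≤ length u
inversions-wordₚ-≤ {n} []      []              = ≤-reflexive (inversions-id {n})
inversions-wordₚ-≤     (k ∷ u) (k+1<n ∷ valid) =
  ≤-trans (inversions-swapValues-≤ k (wordₚ u) k+1<n) (s≤s (inversions-wordₚ-≤ u valid))

inversions-≤-length : ∀ {n} (w : Permutation′ n) {u} → IsExpression w u → inversions w ≤ length u
inversions-≤-length w {u} (valid , evaluates) = subst (_≤ length u)
  (inversions-cong (wordₚ u) w λ x → trans (wordₚ-evalWord u x) (evaluates x))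
  (inversions-wordₚ-≤ u valid)

NoDescentIn : ∀ {n} → Permutation′ n → ℕ → ℕ → Set
NoDescentIn w a b = ∀ k → a ≤ k → k < b → ¬ HasDescentAt (value w) k

noDescentIn-⊆ : ∀ {n} (w : Permutation′ n) {a b a′ b′} → a ≤ a′ → b′ ≤ b →
                NoDescentIn w a b → NoDescentIn w a′ b′
noDescentIn-⊆ w a≤a′ b′≤b no-descent k a′≤k k<b′ =
  no-descent k (≤-trans a≤a′ a′≤k) (<-≤-trans k<b′ b′≤b)

noDescentIn-join : ∀ {n} (w : Permutation′ n) {a b c} →
                   NoDescentIn w a b → NoDescentIn w b c → NoDescentIn w a c
noDescentIn-join w {b = b} below above k a≤k k<c with k <? b
... | yes k<b = below k a≤k k<b
... | no k≮b  = above k (≮⇒≥ k≮b) k<c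

position-mono-≤ : ∀ {n} (w : Permutation′ n) {a} b {i j} → NoDescentIn w a b → a ≤ b →
                  value w i ≡ a → value w j ≡ b → toℕ i ≤ toℕ j
position-mono-≤ w b no-descent a≤b vi≡a vj≡b with m≤n⇒m<n∨m≡n a≤b
... | inj₂ refl = ≤-reflexive (cong toℕ (value-injective w (trans vi≡a (sym vj≡b))))
position-mono-≤ w {a} (suc b) {i} {j} no-descent _ vi≡a vj≡b | inj₁ (s≤s a≤b) =
  ≤-trans (position-mono-≤ w b (noDescentIn-⊆ w ≤-refl (n≤1+n b) no-descent) a≤b vi≡a vj′≡b) j′≤j
  where
  b<n = <-trans (n<1+n b) (subst (_< _) vj≡b (toℕ<n (w ⟨$⟩ʳ j)))
  j′ = positionOf w b b<n
  vj′≡b = value-positionOf w b b<n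
  j′≤j : toℕ j′ ≤ toℕ j
  j′≤j = ≮⇒≥ λ j<j′ → no-descent b a≤b (n<1+n b) (j , j′ , j<j′ , vj≡b , vj′≡b)

position-mono-< : ∀ {n} (w : Permutation′ n) {a b i j} → NoDescentIn w a b → a < b →
                  value w i ≡ a → value w j ≡ b → toℕ i < toℕ j
position-mono-< w {b = b} no-descent a<b vi≡a vj≡b =
  ≤∧≢⇒< (position-mono-≤ w b no-descent (<⇒≤ a<b) vi≡a vj≡b)
        λ i≡j → <-irrefl (trans (sym vi≡a) (trans (cong (value w) (toℕ-injective i≡j)) vj≡b)) a<b

Increasing : ∀ {r m} → (Fin r → Fin m) → Set
Increasing f = ∀ a b → toℕ a < toℕ b → toℕ (f a) < toℕ (f b)

increasing⇒≥ : ∀ {r m} {f : Fin r → Fin m} → Increasing f → ∀ i → toℕ i ≤ toℕ (f i)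
increasing⇒≥ {r} {f = f} f-increasing i =
  subst (λ x → toℕ i ≤ toℕ (f x)) (fromℕ<-toℕ i (toℕ<n i)) (go (toℕ i) (toℕ<n i))
  where
  go : ∀ x (x<r : x < r) → x ≤ toℕ (f (fromℕ< x<r))
  go zero    _     = z≤n
  go (suc x) x+1<r = ≤-<-trans (go x x<r) (f-increasing _ _
    (subst₂ _<_ (sym (toℕ-fromℕ< x<r)) (sym (toℕ-fromℕ< x+1<r)) (n<1+n x)))
    where x<r = <-trans (n<1+n x) x+1<r

increasing⇒monotone : ∀ {r m} {f : Fin r → Fin m} → Increasing f →
                      ∀ {a b} → toℕ a ≤ toℕ b → toℕ (f a) ≤ toℕ (f b)
increasing⇒monotone {f = f} f-increasing {a} {b} a≤b with m≤n⇒m<n∨m≡n a≤b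
... | inj₁ a<b = <⇒≤ (f-increasing a b a<b)
... | inj₂ a≡b = ≤-reflexive (cong (toℕ ∘ f) (toℕ-injective a≡b))

increasing-from-successive : ∀ {r m} (f : Fin (suc r) → Fin m) →
                             (∀ i → toℕ (f (inject₁ i)) < toℕ (f (suc i))) → Increasing f
increasing-from-successive {suc r} f successive zero (suc b) _ = <-≤-trans (successive zero)
  (increasing⇒monotone (increasing-from-successive (f ∘ suc) (successive ∘ suc)) {zero} {b} z≤n)
increasing-from-successive {suc r} f successive (suc a) (suc b) (s<s a<b) =
  increasing-from-successive (f ∘ suc) (successive ∘ suc) a b a<b

no-descent⇒≈id : ∀ {n} (w : Permutation′ n) → (∀ k → ¬ HasDescentAt (value w) k) → w ≈ idₚ
no-descent⇒≈id w no-descent i = toℕ-injective (≤-antisym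
  (subst (λ x → toℕ (w ⟨$⟩ʳ i) ≤ toℕ x) (inverseˡ w) (increasing⇒≥ positions-increasing (w ⟨$⟩ʳ i)))
  (increasing⇒≥ values-increasing i))
  where
  value-position : ∀ x → value w (w ⟨$⟩ˡ x) ≡ toℕ x
  value-position x = cong toℕ (inverseʳ w)
  positions-increasing : Increasing (w ⟨$⟩ˡ_)
  positions-increasing x y x<y =
    position-mono-< w (λ k _ _ → no-descent k) x<y (value-position x) (value-position y)
  values-increasing : Increasing (w ⟨$⟩ʳ_)
  values-increasing i j i<j with <-cmp (value w i) (value w j)
  ... | tri< vi<vj _ _ = vi<vj
  ... | tri≈ _ vi≡vj _ = ⊥-elim (<-irrefl (cong toℕ (value-injective w vi≡vj)) i<j)
  ... | tri> _ _ vj<vi = ⊥-elim (<-asym i<j (subst₂ _<_ (cong toℕ (inverseˡ w)) (cong toℕ (inverseˡ w))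
                           (positions-increasing (w ⟨$⟩ʳ j) (w ⟨$⟩ʳ i) vj<vi)))

descent-induction : ∀ {n} (P : Permutation′ n → Set) →
                    (∀ w → (∀ k → HasDescentAt (value w) k → P (swapValues k w)) → P w) → ∀ w → P w
descent-induction P step w = go w (<-wellFounded (inversions w))
  where
  go : ∀ w → Acc _<_ (inversions w) → P w
  go w (acc rs) = step w λ k descent → go (swapValues k w) (rs (inversions-swapValues-descent k w descent))

IsShortExpression : ∀ {n} → Permutation′ n → List ℕ → Set
IsShortExpression w u = IsExpression w u × length u ≤ inversions w

short⇒reduced : ∀ {n} (w : Permutation′ n) {u} → IsShortExpression w u → IsReduced w u
short⇒reduced w (expression , short) =
  expression , λ _ expression′ → ≤-trans short (inversions-≤-length w expression′)

short-∷ : ∀ {n} (w : Permutation′ n) {k u} → HasDescentAt (value w) k →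
          IsShortExpression (swapValues k w) u → IsShortExpression w (k ∷ u)
short-∷ w {k} descent ((valid , evaluates) , short) =
  ( ( descent⇒suc<n w descent ∷ valid
    , λ j → trans (cong (swapAt k) (evaluates j)) (swapAt-involutive k (w ⟨$⟩ʳ j)))
  , ≤-trans (s≤s short) (inversions-swapValues-descent k w descent))

shortExpression : ∀ {n} (w : Permutation′ n) → ∃ (IsShortExpression w)
shortExpression {n} = descent-induction (∃ ∘ IsShortExpression) step
  where
  step : ∀ w → (∀ k → HasDescentAt (value w) k → ∃ (IsShortExpression (swapValues k w))) →
         ∃ (IsShortExpression w)
  step w ih with anyUpTo? (hasDescentAt? (value w)) n
  ... | yes (k , _ , descent) = let (u , short) = ih k descent in k ∷ u , short-∷ w descent short
  ... | no none = [] , ([] , λ j → sym (no-descent⇒≈id w no-descent j)) , z≤n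
    where
    no-descent : ∀ k → ¬ HasDescentAt (value w) k
    no-descent k descent = none (k , <-trans (n<1+n k) (descent⇒suc<n w descent) , descent)

count-≤-∷ : ∀ K k u → count K u ≤ count K (k ∷ u)
count-≤-∷ K k u with K ≟ k
... | yes K≡k =
  ≤-trans (n≤1+n _) (≤-reflexive (sym (cong length (filter-accept (K ≟_) {k} {u} K≡k))))
... | no K≢k  = ≤-reflexive (sym (cong length (filter-reject (K ≟_) {k} {u} K≢k)))

count-shift-∷ : ∀ {T m} t ts u → count T ts ≤ count (T + m) u →
                count T (t ∷ ts) ≤ count (T + m) ((t + m) ∷ u)
count-shift-∷ {T} {m} t ts u counted with T ≟ t
... | yes refl = begin
  count T (T ∷ ts)            ≡⟨ cong length (filter-accept (T ≟_) {T} {ts} refl) ⟩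
  suc (count T ts)            ≤⟨ s≤s counted ⟩
  suc (count (T + m) u)       ≡⟨ cong length (filter-accept (T + m ≟_) {T + m} {u} refl) ⟨
  count (T + m) ((T + m) ∷ u) ∎
  where open ≤-Reasoning
... | no T≢t = begin
  count T (t ∷ ts)            ≡⟨ cong length (filter-reject (T ≟_) {t} {ts} T≢t) ⟩
  count T ts                  ≤⟨ counted ⟩
  count (T + m) u             ≤⟨ count-≤-∷ (T + m) (t + m) u ⟩
  count (T + m) ((t + m) ∷ u) ∎
  where open ≤-Reasoning

IsDescentWord : ∀ {r} → (Fin r → ℕ) → List ℕ → Set
IsDescentWord q []       = ⊤
IsDescentWord q (t ∷ ts) = HasDescentAt q t × IsDescentWord (swapℕ t ∘ q) ts

isDescentWord? : ∀ {r} (q : Fin r → ℕ) ts → Dec (IsDescentWord q ts)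
isDescentWord? q []       = yes tt
isDescentWord? q (t ∷ ts) = hasDescentAt? q t ×-dec isDescentWord? (swapℕ t ∘ q) ts

descent-shift : ∀ {n r} {q : Fin r → ℕ} (w : Permutation′ n) {g : Fin r → Fin n} {m} →
                Increasing g → (∀ c → value w (g c) ≡ q c + m) →
                ∀ {t} → HasDescentAt q t → HasDescentAt (value w) (t + m)
descent-shift w {m = m} g-increasing values (a , b , a<b , qa≡t+1 , qb≡t) =
  _ , _ , g-increasing a b a<b , trans (values a) (cong (_+ m) qa≡t+1) , trans (values b) (cong (_+ m) qb≡t)

shortExpression-of-consecutive : ∀ {n r} (q : Fin r → ℕ) ts → IsDescentWord q ts →
  (w : Permutation′ n) (g : Fin r → Fin n) → Increasing g → ∀ m → (∀ c → value w (g c) ≡ q c + m) →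
  ∀ T → ∃ λ u → IsShortExpression w u × count T ts ≤ count (T + m) u
shortExpression-of-consecutive q [] _ w g _ m _ T = let (u , short) = shortExpression w in u , short , z≤n
shortExpression-of-consecutive q (t ∷ ts) (descent , descents) w g g-increasing m values T =
  let (u , short , counted) = shortExpression-of-consecutive
        (swapℕ t ∘ q) ts descents (swapValues (t + m) w) g g-increasing m values′ T
  in (t + m) ∷ u , short-∷ w descent′ short , count-shift-∷ t ts u counted
  where
  descent′ = descent-shift w g-increasing values descent
  values′ : ∀ c → value (swapValues (t + m) w) (g c) ≡ swapℕ t (q c) + m
  values′ c = begin
    value (swapValues (t + m) w) (g c) ≡⟨ value-swapValues (t + m) w (descent⇒suc<n w descent′) (g c) ⟩
    swapℕ (t + m) (value w (g c))      ≡⟨ cong (swapℕ (t + m)) (values c) ⟩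
    swapℕ (t + m) (q c + m)            ≡⟨ swapℕ-+ʳ t (q c) m ⟩
    swapℕ t (q c) + m                  ∎
    where open ≡-Reasoning

ShortTripleExpression : ∀ {n} → Permutation′ n → Set
ShortTripleExpression w = ∃ λ u → IsShortExpression w u × ∃ λ k → 3 ≤ count k u

tripleExpression-of-consecutive : ∀ {n r} (q : Vec ℕ r) ts {_ : True (isDescentWord? (lookup q) ts)}
  T {_ : True (3 ≤? count T ts)} (w : Permutation′ n) (g : Fin r → Fin n) → Increasing g →
  ∀ m → (∀ c → value w (g c) ≡ lookup q c + m) → ShortTripleExpression w
tripleExpression-of-consecutive q ts {descents} T {thrice} w g g-increasing m values =
  let (u , short , counted) =
        shortExpression-of-consecutive (lookup q) ts (toWitness descents) w g g-increasing m values T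
  in u , short , T + m , ≤-trans (toWitness thrice) counted

SameOrder : ∀ {r} → (Fin r → ℕ) → (Fin r → ℕ) → Set
SameOrder p v = ∀ a b → v a < v b ⇔ p a < p b

Hits : ∀ {r} → (Fin r → ℕ) → ℕ → Set
Hits v k = ∃ λ c → v c ≡ k

hits? : ∀ {r} (v : Fin r → ℕ) k → Dec (Hits v k)
hits? v k = any? λ c → v c ≟ k

IsStuck : ∀ {n r} → Permutation′ n → (Fin r → Fin n) → Set
IsStuck w f = ∀ k → HasDescentAt (value w) k → Hits (value w ∘ f) k × Hits (value w ∘ f) (suc k)

sameOrder-swapValues : ∀ {n r} {p : Fin r → ℕ} k (w : Permutation′ n) (f : Fin r → Fin n) → suc k < n →
  ¬ (Hits (value w ∘ f) k × Hits (value w ∘ f) (suc k)) →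
  SameOrder p (value w ∘ f) → SameOrder p (value (swapValues k w) ∘ f)
sameOrder-swapValues k w f k+1<n not-both same-order a b = mk⇔
  (λ lt → Equivalence.to (same-order a b) (reflect (subst₂ _<_ (swapped a) (swapped b) lt)))
  (λ lt → subst₂ _<_ (sym (swapped a)) (sym (swapped b))
    (swapℕ-mono-< k (Equivalence.from (same-order a b) lt)
      λ (va≡k , vb≡k+1) → not-both ((a , va≡k) , (b , vb≡k+1))))
  where
  swapped = λ c → value-swapValues k w k+1<n (f c)
  reflect : swapℕ k (value w (f a)) < swapℕ k (value w (f b)) → value w (f a) < value w (f b)
  reflect lt with swapℕ-reflects-< k lt
  ... | inj₁ va<vb            = va<vb
  ... | inj₂ (va≡k+1 , vb≡k) = ⊥-elim (not-both ((b , vb≡k) , (a , va≡k+1)))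

tripleExpression-of-stuck : ∀ {n r} (p : Fin r → ℕ) (f : Fin r → Fin n) →
  (∀ w → SameOrder p (value w ∘ f) → IsStuck w f → ShortTripleExpression w) →
  ∀ w → SameOrder p (value w ∘ f) → ShortTripleExpression w
tripleExpression-of-stuck {n} p f stuck-case = descent-induction _ step
  where
  step : ∀ w → (∀ k → HasDescentAt (value w) k → SameOrder p (value (swapValues k w) ∘ f) →
                ShortTripleExpression (swapValues k w)) →
         SameOrder p (value w ∘ f) → ShortTripleExpression w
  step w ih same-order with anyUpTo?
    (λ k → hasDescentAt? (value w) k ×-dec ¬? (hits? (value w ∘ f) k ×-dec hits? (value w ∘ f) (suc k))) n
  ... | yes (k , _ , descent , not-both) =
    let same-order′ = sameOrder-swapValues k w f (descent⇒suc<n w descent) not-both same-order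
        (u , short , K , thrice) = ih k descent same-order′
    in k ∷ u , short-∷ w descent short , K , ≤-trans thrice (count-≤-∷ K k u)
  ... | no none = stuck-case w same-order stuck
    where
    stuck : IsStuck w f
    stuck k descent with hits? (value w ∘ f) k ×-dec hits? (value w ∘ f) (suc k)
    ... | yes both    = both
    ... | no not-both = ⊥-elim (none (k , <-trans (n<1+n k) (descent⇒suc<n w descent) , descent , not-both))

module StuckOccurrence {n r} {w : Permutation′ n} {p : Fin r → ℕ} {f : Fin r → Fin n}
  (f-increasing : Increasing f) (same-order : SameOrder p (value w ∘ f)) (stuck : IsStuck w f) where

  v : Fin r → ℕ
  v c = value w (f c)

  Consecutive : Fin r → Fin r → Set
  Consecutive α β = ∀ c → ¬ (p α < p c × p c < p β)

  consecutive? : ∀ α β → Dec (Consecutive α β)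
  consecutive? α β = all? λ c → ¬? ((p α <? p c) ×-dec (p c <? p β))

  value-order : ∀ a b → {True (p a <? p b)} → v a < v b
  value-order a b {pa<pb} = Equivalence.from (same-order a b) (toWitness pa<pb)

  position-order : ∀ a b → {True (toℕ a <? toℕ b)} → toℕ (f a) < toℕ (f b)
  position-order a b {a<b} = f-increasing a b (toWitness a<b)

  outside : ∀ {α β} → Consecutive α β → ∀ c → v c ≤ v α ⊎ v β ≤ v c
  outside {α} {β} consecutive c with v c ≤? v α | v β ≤? v c
  ... | yes vc≤vα | _         = inj₁ vc≤vα
  ... | no _      | yes vβ≤vc = inj₂ vβ≤vc
  ... | no vc≰vα  | no vβ≰vc  = ⊥-elim (consecutive c
    (Equivalence.to (same-order α c) (≰⇒> vc≰vα) , Equivalence.to (same-order c β) (≰⇒> vβ≰vc)))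

  descent-between : ∀ {α β} → Consecutive α β → ∀ {k} → v α ≤ k → k < v β →
                    HasDescentAt (value w) k → k ≡ v α × v β ≡ suc k
  descent-between {α} {β} consecutive {k} vα≤k k<vβ descent with stuck k descent
  ... | (c , vc≡k) , (c′ , vc′≡k+1) = k≡vα , vβ≡k+1
    where
    k≡vα : k ≡ v α
    k≡vα with outside consecutive c
    ... | inj₁ vc≤vα = ≤-antisym (subst (_≤ v α) vc≡k vc≤vα) vα≤k
    ... | inj₂ vβ≤vc = ⊥-elim (<⇒≱ k<vβ (subst (v β ≤_) vc≡k vβ≤vc))
    vβ≡k+1 : v β ≡ suc k
    vβ≡k+1 with outside consecutive c′
    ... | inj₁ vc′≤vα = ⊥-elim (<⇒≱ (subst (_≤ v α) vc′≡k+1 vc′≤vα) vα≤k)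
    ... | inj₂ vβ≤vc′ = ≤-antisym (subst (v β ≤_) vc′≡k+1 vβ≤vc′) k<vβ

  consecutive-ascent : ∀ α β → {True (consecutive? α β)} → {True (toℕ α <? toℕ β)} →
                       NoDescentIn w (v α) (v β)
  consecutive-ascent α β {consecutive} {α<β} k vα≤k k<vβ descent@(i , j , i<j , vi≡k+1 , vj≡k)
    with descent-between (toWitness consecutive) vα≤k k<vβ descent
  ... | refl , vβ≡k+1
    with value-injective w (trans vi≡k+1 (sym vβ≡k+1)) | value-injective w vj≡k
  ... | refl | refl = <-asym i<j (position-order α β {α<β})

  consecutive-inversion : ∀ α β → {True (consecutive? α β)} → {True (p α <? p β)} →
                          {True (toℕ β <? toℕ α)} → v β ≡ suc (v α)
  consecutive-inversion α β {consecutive} {pα<pβ} {β<α} with v β ≟ suc (v α)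
  ... | yes vβ≡vα+1 = vβ≡vα+1
  ... | no vβ≢vα+1  = ⊥-elim (<-asym (position-order β α {β<α})
    (position-mono-< w no-descent (value-order α β {pα<pβ}) refl refl))
    where
    no-descent : NoDescentIn w (v α) (v β)
    no-descent k vα≤k k<vβ descent with descent-between (toWitness consecutive) vα≤k k<vβ descent
    ... | refl , vβ≡k+1 = vβ≢vα+1 vβ≡k+1

suc-pred-< : ∀ {a b} → a < b → suc (pred b) ≡ b
suc-pred-< (s≤s _) = refl

tripleExpression-of-stuck-4321 : ∀ {n} (f : Fin 4 → Fin n) → Increasing f →
  ∀ w → SameOrder (lookup p4321) (value w ∘ f) → IsStuck w f → ShortTripleExpression w
tripleExpression-of-stuck-4321 f f-increasing w same-order stuck =
  tripleExpression-of-consecutive q (0 ∷ 1 ∷ 0 ∷ 2 ∷ 1 ∷ 0 ∷ []) 0 w f f-increasing (v 3F) values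
  where
  open StuckOccurrence {w = w} {lookup p4321} {f} f-increasing same-order stuck
  q = 3 ∷ 2 ∷ 1 ∷ 0 ∷ []
  v₂≡v₃+1 = consecutive-inversion 3F 2F
  v₁≡v₂+1 = consecutive-inversion 2F 1F
  v₀≡v₁+1 = consecutive-inversion 1F 0F
  values : ∀ c → v c ≡ lookup q c + v 3F
  values 0F = trans v₀≡v₁+1 (cong suc (trans v₁≡v₂+1 (cong suc v₂≡v₃+1)))
  values 1F = trans v₁≡v₂+1 (cong suc v₂≡v₃+1)
  values 2F = v₂≡v₃+1
  values 3F = refl

-- The value v₀ + 1 lies in the ascending run from v₀ to v₁ and takes the place of v₁.
tripleExpression-of-stuck-3421 : ∀ {n} (f : Fin 4 → Fin n) → Increasing f →
  ∀ w → SameOrder (lookup p3421) (value w ∘ f) → IsStuck w f → ShortTripleExpression w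
tripleExpression-of-stuck-3421 {n} f f-increasing w same-order stuck =
  tripleExpression-of-consecutive q (1 ∷ 0 ∷ 1 ∷ 2 ∷ 1 ∷ []) 1 w g g-increasing (v 3F) values
  where
  open StuckOccurrence {w = w} {lookup p3421} {f} f-increasing same-order stuck
  q = 2 ∷ 3 ∷ 1 ∷ 0 ∷ []
  v₂≡v₃+1 = consecutive-inversion 3F 2F
  v₀≡v₂+1 = consecutive-inversion 2F 0F
  v₀<v₁ = value-order 0F 1F
  ascent = consecutive-ascent 0F 1F
  v₀+1<n = ≤-<-trans v₀<v₁ (toℕ<n (w ⟨$⟩ʳ f 1F))
  P = positionOf w (suc (v 0F)) v₀+1<n
  vP≡v₀+1 = value-positionOf w (suc (v 0F)) v₀+1<n
  g : Fin 4 → Fin n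
  g 0F = f 0F
  g 1F = P
  g 2F = f 2F
  g 3F = f 3F
  g-increasing : Increasing g
  g-increasing = increasing-from-successive g λ
    { 0F → position-mono-< w {j = P} (noDescentIn-⊆ w ≤-refl v₀<v₁ ascent) (n<1+n _) refl vP≡v₀+1
    ; 1F → ≤-<-trans
             (position-mono-≤ w (v 1F) {P} (noDescentIn-⊆ w (n≤1+n _) ≤-refl ascent) v₀<v₁ vP≡v₀+1 refl)
             (position-order 1F 2F)
    ; 2F → position-order 2F 3F }
  values : ∀ c → value w (g c) ≡ lookup q c + v 3F
  values 0F = trans v₀≡v₂+1 (cong suc v₂≡v₃+1)
  values 1F = trans vP≡v₀+1 (cong suc (values 0F))
  values 2F = v₂≡v₃+1
  values 3F = refl

-- The value v₃ - 1 lies in the ascending run from v₂ to v₃ and takes the place of v₂.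
tripleExpression-of-stuck-4312 : ∀ {n} (f : Fin 4 → Fin n) → Increasing f →
  ∀ w → SameOrder (lookup p4312) (value w ∘ f) → IsStuck w f → ShortTripleExpression w
tripleExpression-of-stuck-4312 {n} f f-increasing w same-order stuck =
  tripleExpression-of-consecutive q (1 ∷ 2 ∷ 1 ∷ 0 ∷ 1 ∷ []) 1 w g g-increasing m values
  where
  open StuckOccurrence {w = w} {lookup p4312} {f} f-increasing same-order stuck
  q = 3 ∷ 2 ∷ 0 ∷ 1 ∷ []
  v₁≡v₃+1 = consecutive-inversion 3F 1F
  v₀≡v₁+1 = consecutive-inversion 1F 0F
  v₂<v₃ = value-order 2F 3F
  ascent = consecutive-ascent 2F 3F
  m = pred (v 3F)
  v₂≤m = <⇒≤pred v₂<v₃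
  v₃≡m+1 = sym (suc-pred-< v₂<v₃)
  m<n = ≤-<-trans pred[n]≤n (toℕ<n (w ⟨$⟩ʳ f 3F))
  Q = positionOf w m m<n
  vQ≡m = value-positionOf w m m<n
  g : Fin 4 → Fin n
  g 0F = f 0F
  g 1F = f 1F
  g 2F = Q
  g 3F = f 3F
  g-increasing : Increasing g
  g-increasing = increasing-from-successive g λ
    { 0F → position-order 0F 1F
    ; 1F → <-≤-trans (position-order 1F 2F)
                     (position-mono-≤ w m {f 2F} (noDescentIn-⊆ w ≤-refl pred[n]≤n ascent) v₂≤m refl vQ≡m)
    ; 2F → position-mono-< w {i = Q} (noDescentIn-⊆ w v₂≤m ≤-refl ascent)
             (≤-reflexive (sym v₃≡m+1)) vQ≡m refl }
  values : ∀ c → value w (g c) ≡ lookup q c + m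
  values 0F = trans v₀≡v₁+1 (cong suc (values 1F))
  values 1F = trans v₁≡v₃+1 (cong suc v₃≡m+1)
  values 2F = vQ≡m
  values 3F = v₃≡m+1

-- v₀, …, v₂ and v₃, …, v₅ are ascending runs; as v₀ = v₅ + 1, the three smallest values of the
-- upper run and the three largest of the lower one form a consecutive occurrence.
tripleExpression-of-stuck-456123 : ∀ {n} (f : Fin 6 → Fin n) → Increasing f →
  ∀ w → SameOrder (lookup p456123) (value w ∘ f) → IsStuck w f → ShortTripleExpression w
tripleExpression-of-stuck-456123 {n} f f-increasing w same-order stuck =
  tripleExpression-of-consecutive q (2 ∷ 1 ∷ 0 ∷ 3 ∷ 2 ∷ 1 ∷ 4 ∷ 3 ∷ 2 ∷ []) 2 w g g-increasing m values
  where
  open StuckOccurrence {w = w} {lookup p456123} {f} f-increasing same-order stuck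
  q = 3 ∷ 4 ∷ 5 ∷ 0 ∷ 1 ∷ 2 ∷ []
  v₀≡v₅+1 = consecutive-inversion 5F 0F
  upper = noDescentIn-join w (consecutive-ascent 0F 1F) (consecutive-ascent 1F 2F)
  lower = noDescentIn-join w (consecutive-ascent 3F 4F) (consecutive-ascent 4F 5F)
  v₀<v₁ = value-order 0F 1F
  v₀+2≤v₂ = ≤-trans (s≤s v₀<v₁) (value-order 1F 2F)
  v₀+1<n = ≤-<-trans v₀<v₁ (toℕ<n (w ⟨$⟩ʳ f 1F))
  v₀+2<n = ≤-<-trans v₀+2≤v₂ (toℕ<n (w ⟨$⟩ʳ f 2F))
  P₁ = positionOf w (1 + v 0F) v₀+1<n
  P₂ = positionOf w (2 + v 0F) v₀+2<n
  vP₁ = value-positionOf w (1 + v 0F) v₀+1<n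
  vP₂ = value-positionOf w (2 + v 0F) v₀+2<n
  v₄<v₅ = value-order 4F 5F
  m₁ = pred (v 5F)
  v₅≡m₁+1 = sym (suc-pred-< v₄<v₅)
  v₃<m₁ = <-≤-trans (value-order 3F 4F) (<⇒≤pred v₄<v₅)
  m = pred m₁
  m₁≡m+1 = sym (suc-pred-< v₃<m₁)
  v₃≤m = <⇒≤pred v₃<m₁
  m₁<n = ≤-<-trans pred[n]≤n (toℕ<n (w ⟨$⟩ʳ f 5F))
  m<n = ≤-<-trans pred[n]≤n m₁<n
  Q₀ = positionOf w m m<n
  Q₁ = positionOf w m₁ m₁<n
  vQ₀ = value-positionOf w m m<n
  vQ₁ = value-positionOf w m₁ m₁<n
  g : Fin 6 → Fin n
  g 0F = f 0F
  g 1F = P₁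
  g 2F = P₂
  g 3F = Q₀
  g 4F = Q₁
  g 5F = f 5F
  g-increasing : Increasing g
  g-increasing = increasing-from-successive g λ
    { 0F → position-mono-< w {j = P₁} (noDescentIn-⊆ w ≤-refl (≤-trans (n≤1+n _) v₀+2≤v₂) upper)
             (n<1+n _) refl vP₁
    ; 1F → position-mono-< w {i = P₁} {P₂} (noDescentIn-⊆ w (n≤1+n _) v₀+2≤v₂ upper) (n<1+n _) vP₁ vP₂
    ; 2F → ≤-<-trans
             (position-mono-≤ w (v 2F) {P₂} (noDescentIn-⊆ w (m≤n+m _ 2) ≤-refl upper) v₀+2≤v₂ vP₂ refl)
             (<-≤-trans (position-order 2F 3F)
               (position-mono-≤ w m {f 3F} (noDescentIn-⊆ w ≤-refl (≤-trans pred[n]≤n pred[n]≤n) lower)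
                  v₃≤m refl vQ₀))
    ; 3F → position-mono-< w {i = Q₀} {Q₁} (noDescentIn-⊆ w v₃≤m pred[n]≤n lower)
             (≤-reflexive (sym m₁≡m+1)) vQ₀ vQ₁
    ; 4F → position-mono-< w {i = Q₁} (noDescentIn-⊆ w (<⇒≤ v₃<m₁) ≤-refl lower)
             (≤-reflexive (sym v₅≡m₁+1)) vQ₁ refl }
  v₅≡m+2 : v 5F ≡ 2 + m
  v₅≡m+2 = trans v₅≡m₁+1 (cong suc m₁≡m+1)
  v₀≡m+3 : v 0F ≡ 3 + m
  v₀≡m+3 = trans v₀≡v₅+1 (cong suc v₅≡m+2)
  values : ∀ c → value w (g c) ≡ lookup q c + m
  values 0F = v₀≡m+3
  values 1F = trans vP₁ (cong (1 +_) v₀≡m+3)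
  values 2F = trans vP₂ (cong (2 +_) v₀≡m+3)
  values 3F = vQ₀
  values 4F = trans vQ₁ m₁≡m+1
  values 5F = v₅≡m+2

tripleExpression-of-containment : ∀ {n r} (π : Vec ℕ r) →
  (∀ (f : Fin r → Fin n) → Increasing f → ∀ w → SameOrder (lookup π) (value w ∘ f) → IsStuck w f →
     ShortTripleExpression w) →
  ∀ w → Contains w π → ShortTripleExpression w
tripleExpression-of-containment π stuck-case w (f , f-increasing , same-order) =
  tripleExpression-of-stuck (lookup π) f (stuck-case f f-increasing) w same-order

lemma4p4 : (n : ℕ) (w : Permutation′ n) →
    (Contains w p3421 ⊎ Contains w p4312 ⊎ Contains w p4321 ⊎ Contains w p456123) →
    Σ (List ℕ) λ u → IsReduced w u × Σ ℕ λ k → 3 ≤ count k u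
lemma4p4 n w contains =
  let (u , short , k , thrice) = triple contains in u , short⇒reduced w short , k , thrice
  where
  triple : Contains w p3421 ⊎ Contains w p4312 ⊎ Contains w p4321 ⊎ Contains w p456123 →
           ShortTripleExpression w
  triple (inj₁ c)               = tripleExpression-of-containment p3421 tripleExpression-of-stuck-3421 w c
  triple (inj₂ (inj₁ c))        = tripleExpression-of-containment p4312 tripleExpression-of-stuck-4312 w c
  triple (inj₂ (inj₂ (inj₁ c))) = tripleExpression-of-containment p4321 tripleExpression-of-stuck-4321 w c
  triple (inj₂ (inj₂ (inj₂ c))) =
    tripleExpression-of-containment p456123 tripleExpression-of-stuck-456123 w c
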